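{- For any (purely) periodic infinite word $\mathbf x$, i.e., $\mathbf x=v^\omega$ for some nonempty finite word $v$, the abelian closure $\mathcal A(\mathbf x)$ is a finite set.
   Context: For finite words, $u\sim_{ab}v$ means each letter occurs equally many times in $u$ and $v$. With $\mathcal L$ the set of factors, $\mathcal A(\mathbf x)=\{\mathbf y : \forall u\in\mathcal L(\mathbf y)\ \exists v\in\mathcal L(\mathbf x),\ u\sim_{ab}v\}$ (over the alphabet of $\mathbf x$). -}

module Defs where

open import Data.Nat using (ℕ; suc; _+_)
open import Data.Nat.DivMod using (_mod_)
open import Data.List using (List; []; _∷_; length; map; filter; upTo)
open import Data.List.Membership.Propositional using (_∈_)
open import Data.Vec using (Vec; lookup)
open import Data.Product using (Σ; ∃; _×_)
open import Relation.Binary.PropositionalEquality using (_≡_)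
open import Relation.Binary.Definitions using (DecidableEquality)
open import Relation.Nullary.Decidable using (⌊_⌋)

module _ {A : Set} (_≟_ : DecidableEquality A) where

  InfWord : Set
  InfWord = ℕ → A

  count : A → List A → ℕ
  count a []       = 0
  count a (b ∷ u)  with b ≟ a
  ... | Relation.Nullary.Decidable.yes _ = suc (count a u)
  ... | Relation.Nullary.Decidable.no  _ = count a u

  _∼ab_ : List A → List A → Set
  u ∼ab v = ∀ (a : A) → count a u ≡ count a v

  factorAt : InfWord → ℕ → ℕ → List A
  factorAt x i n = map (λ k → x (i + k)) (upTo n)

  IsFactor : List A → InfWord → Set
  IsFactor u x = ∃ λ i → u ≡ factorAt x i (length u)

  InAbClosure : InfWord → InfWord → Set
  InAbClosure x y = ∀ (u : List A) → IsFactor u y → ∃ λ v → IsFactor v x × (u ∼ab v)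

  IsPurelyPeriodic : InfWord → Set
  IsPurelyPeriodic x = Σ ℕ λ k → Σ (Vec A (suc k)) λ v → ∀ (n : ℕ) → x n ≡ lookup v (n mod suc k)

  -- a set S of infinite words (equality = letterwise equality) is finite:
  -- it is covered by a finite list of infinite words
  FiniteSet : (InfWord → Set) → Set
  FiniteSet S = ∃ λ (L : List InfWord) → ∀ (y : InfWord) → S y → ∃ λ z → z ∈ L × (∀ (n : ℕ) → y n ≡ z n)

-- Every window of length p of x = v^ω is a cyclic shift of v, so all of them have the same Parikh
-- vector.  Abelian equivalence preserves length, hence the same holds for every y ∈ 𝓐(x); and
-- sliding a window of length p by one position keeps its Parikh vector iff the letter leaving it
-- equals the letter entering it, so y is p-periodic as well.  Since every letter of y is a letter
-- of v, y is one of the finitely many words w^ω with w ∈ (letters of v)^p.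
module Submission where

open import Defs
open import Relation.Binary.Definitions using (DecidableEquality)
open import Data.Nat using (ℕ; zero; suc; _+_; _*_; _%_; _/_; _<_; s≤s; z≤n; NonZero)
open import Data.Nat.Properties using (+-identityʳ; +-suc; +-assoc; +-comm; +-cancelˡ-≡; <⇒≢; +-commutativeSemigroup)
open import Algebra.Properties.CommutativeSemigroup +-commutativeSemigroup using (x∙yz≈y∙xz)
open import Data.Nat.DivMod using (_mod_; m≡m%n+[m/n]*n; [m+n]%n≡m%n; m%n<n)
open import Data.Fin as Fin using (toℕ)
open import Data.Fin.Properties using (toℕ-fromℕ<; fromℕ<-cong)
open import Data.List using (List; []; _∷_; [_]; _++_; _∷ʳ_; length; map; upTo; applyUpTo; cartesianProductWith)
open import Data.List.Properties using (map-++; map-cong; map-upTo; map-applyUpTo; length-map; length-upTo; upTo-∷ʳ; length-++-sucʳ)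
open import Data.List.Membership.Propositional using (_∈_)
open import Data.List.Membership.Propositional.Properties using (∈-∃++; ∈-map⁺; ∈-cartesianProductWith⁺)
open import Data.List.Relation.Unary.Any using (here; there)
open import Data.Vec as Vec using (Vec; lookup; tabulate; toList)
open import Data.Vec.Properties using (lookup∘tabulate)
open import Data.Vec.Membership.Propositional.Properties using (∈-lookup; ∈-toList⁺)
open import Data.Product using (∃; _×_; _,_)
open import Function using (_∘_)
open import Relation.Nullary using (yes; no)
open import Data.Empty using (⊥-elim)
open import Relation.Binary.PropositionalEquality using (_≡_; refl; sym; trans; cong; cong₂; subst; subst₂; module ≡-Reasoning)

module _ {A : Set} where

  HasPeriod : ℕ → (ℕ → A) → Set
  HasPeriod p z = ∀ i → z (i + p) ≡ z i

  hasPeriod-+* : ∀ {p z} → HasPeriod p z → ∀ r q → z (r + q * p) ≡ z r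
  hasPeriod-+* {z = z} per r zero = cong z (+-identityʳ r)
  hasPeriod-+* {p} {z} per r (suc q) = begin
    z (r + (p + q * p)) ≡⟨ cong z (cong (r +_) (+-comm p (q * p))) ⟩
    z (r + (q * p + p)) ≡⟨ cong z (sym (+-assoc r (q * p) p)) ⟩
    z (r + q * p + p)   ≡⟨ per (r + q * p) ⟩
    z (r + q * p)       ≡⟨ hasPeriod-+* per r q ⟩
    z r                 ∎
    where open ≡-Reasoning

  hasPeriod-% : ∀ {p z} .{{_ : NonZero p}} → HasPeriod p z → ∀ n → z n ≡ z (n % p)
  hasPeriod-% {p} {z} per n = trans (cong z (m≡m%n+[m/n]*n n p)) (hasPeriod-+* per (n % p) (n / p))

  cycle : ∀ {k} → Vec A (suc k) → ℕ → A
  cycle {k} w n = lookup w (n mod suc k)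

  cycle-hasPeriod : ∀ {k} (w : Vec A (suc k)) → HasPeriod (suc k) (cycle w)
  cycle-hasPeriod {k} w i = cong (lookup w) (fromℕ<-cong _ _ ([m+n]%n≡m%n i (suc k)) _ _)

  hasPeriod⇒≡cycle : ∀ {k z} → HasPeriod (suc k) z → ∀ n → z n ≡ cycle (tabulate (z ∘ toℕ)) n
  hasPeriod⇒≡cycle {k} {z} per n = begin
    z n                                            ≡⟨ hasPeriod-% per n ⟩
    z (n % suc k)                                  ≡⟨ cong z (sym (toℕ-fromℕ< (m%n<n n (suc k)))) ⟩
    z (toℕ (n mod suc k))                          ≡⟨ sym (lookup∘tabulate (z ∘ toℕ) (n mod suc k)) ⟩
    lookup (tabulate (z ∘ toℕ)) (n mod suc k)      ∎
    where open ≡-Reasoning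

  vecsOver : List A → (n : ℕ) → List (Vec A n)
  vecsOver L zero    = [ Vec.[] ]
  vecsOver L (suc n) = cartesianProductWith Vec._∷_ L (vecsOver L n)

  ∈-vecsOver : ∀ {L n} (w : Vec A n) → (∀ i → lookup w i ∈ L) → w ∈ vecsOver L n
  ∈-vecsOver Vec.[]       _  = here refl
  ∈-vecsOver (a Vec.∷ w) w⊆L = ∈-cartesianProductWith⁺ Vec._∷_ (w⊆L Fin.zero) (∈-vecsOver w (w⊆L ∘ Fin.suc))

module _ {A : Set} (_≟_ : DecidableEquality A) where

  private
    infix 4 _∼_
    _∼_ : List A → List A → Set
    _∼_ = _∼ab_ _≟_

    # : A → List A → ℕ
    # = count _≟_

    factor : InfWord _≟_ → ℕ → ℕ → List A
    factor = factorAt _≟_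

  count-++ : ∀ a u w → # a (u ++ w) ≡ # a u + # a w
  count-++ a []      w = refl
  count-++ a (b ∷ u) w with b ≟ a
  ... | yes _ = cong suc (count-++ a u w)
  ... | no  _ = count-++ a u w

  count-∷-self : ∀ a u → 0 < # a (a ∷ u)
  count-∷-self a u with a ≟ a
  ... | yes _   = s≤s z≤n
  ... | no  a≢a = ⊥-elim (a≢a refl)

  count>0⇒∈ : ∀ {a} w → 0 < # a w → a ∈ w
  count>0⇒∈ {a} (b ∷ w) c>0 with b ≟ a
  ... | yes b≡a = here (sym b≡a)
  ... | no  _   = there (count>0⇒∈ w c>0)

  ∼-++-comm : ∀ u w → u ++ w ∼ w ++ u
  ∼-++-comm u w a = begin
    # a (u ++ w)    ≡⟨ count-++ a u w ⟩
    # a u + # a w   ≡⟨ +-comm (# a u) (# a w) ⟩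
    # a w + # a u   ≡⟨ sym (count-++ a w u) ⟩
    # a (w ++ u)    ∎
    where open ≡-Reasoning

  ∼-++-cancelˡ : ∀ {u w u′ w′} → u ++ w ∼ u′ ++ w′ → u ∼ u′ → w ∼ w′
  ∼-++-cancelˡ {u} {w} {u′} {w′} uw∼ u∼u′ a = +-cancelˡ-≡ (# a u) _ _ (begin
    # a u + # a w     ≡⟨ sym (count-++ a u w) ⟩
    # a (u ++ w)      ≡⟨ uw∼ a ⟩
    # a (u′ ++ w′)    ≡⟨ count-++ a u′ w′ ⟩
    # a u′ + # a w′   ≡⟨ cong (_+ # a w′) (sym (u∼u′ a)) ⟩
    # a u + # a w′    ∎)
    where open ≡-Reasoning

  ∼-++-cancelʳ : ∀ {u w u′ w′} → u ++ w ∼ u′ ++ w′ → w ∼ w′ → u ∼ u′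
  ∼-++-cancelʳ {u} {w} {u′} {w′} uw∼ =
    ∼-++-cancelˡ {w} {u} {w′} {u′} (λ a → trans (∼-++-comm w u a) (trans (uw∼ a) (∼-++-comm u′ w′ a)))

  ∼-[]⇒≡ : ∀ {a b} → [ a ] ∼ [ b ] → a ≡ b
  ∼-[]⇒≡ {a} {b} a∼b with a ≟ b | a∼b b
  ... | yes a≡b | _ = a≡b
  ... | no  _   | eq = ⊥-elim (<⇒≢ (count-∷-self b []) eq)

  ∼-shift : ∀ a ys zs → ys ++ a ∷ zs ∼ a ∷ ys ++ zs
  ∼-shift a ys zs c = begin
    # c (ys ++ [ a ] ++ zs)            ≡⟨ count-++ c ys ([ a ] ++ zs) ⟩
    # c ys + # c ([ a ] ++ zs)         ≡⟨ cong (# c ys +_) (count-++ c [ a ] zs) ⟩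
    # c ys + (# c [ a ] + # c zs)      ≡⟨ x∙yz≈y∙xz (# c ys) (# c [ a ]) (# c zs) ⟩
    # c [ a ] + (# c ys + # c zs)      ≡⟨ cong (# c [ a ] +_) (sym (count-++ c ys zs)) ⟩
    # c [ a ] + # c (ys ++ zs)         ≡⟨ sym (count-++ c [ a ] (ys ++ zs)) ⟩
    # c (a ∷ ys ++ zs)                 ∎
    where open ≡-Reasoning

  ∼⇒length≡ : ∀ u w → u ∼ w → length u ≡ length w
  ∼⇒length≡ []      []      _   = refl
  ∼⇒length≡ []      (b ∷ w) []∼ = ⊥-elim (<⇒≢ (count-∷-self b w) ([]∼ b))
  ∼⇒length≡ (a ∷ u) w       u∼w with ∈-∃++ (count>0⇒∈ w (subst (0 <_) (u∼w a) (count-∷-self a u)))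
  ... | ys , zs , refl = trans (cong suc (∼⇒length≡ u (ys ++ zs) u∼ys++zs)) (sym (length-++-sucʳ ys a zs))
    where
    u∼ys++zs : u ∼ ys ++ zs
    u∼ys++zs = ∼-++-cancelˡ {[ a ]} {u} {[ a ]} {ys ++ zs} (λ c → trans (u∼w c) (∼-shift a ys zs c)) (λ _ → refl)

  factor-length : ∀ z i n → length (factor z i n) ≡ n
  factor-length z i n = trans (length-map _ (upTo n)) (length-upTo n)

  factor-isFactor : ∀ z i n → IsFactor _≟_ (factor z i n) z
  factor-isFactor z i n = i , cong (factor z i) (sym (factor-length z i n))

  factor-suc : ∀ z i n → factor z i (suc n) ≡ z i ∷ factor z (suc i) n
  factor-suc z i n = cong₂ _∷_ (cong z (+-identityʳ i)) (begin
    map (λ k → z (i + k)) (applyUpTo suc n)   ≡⟨ map-applyUpTo suc (λ k → z (i + k)) n ⟩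
    applyUpTo (λ k → z (i + suc k)) n          ≡⟨ sym (map-upTo (λ k → z (i + suc k)) n) ⟩
    map (λ k → z (i + suc k)) (upTo n)         ≡⟨ map-cong (λ k → cong z (+-suc i k)) (upTo n) ⟩
    factor z (suc i) n                         ∎)
    where open ≡-Reasoning

  factor-∷ʳ : ∀ z i n → factor z i (suc n) ≡ factor z i n ∷ʳ z (i + n)
  factor-∷ʳ z i n = trans (cong (map (λ k → z (i + k))) (sym (upTo-∷ʳ n))) (map-++ (λ k → z (i + k)) (upTo n) [ n ])

  factor-slide : ∀ z i p → factor z i p ++ [ z (i + p) ] ∼ factor z (suc i) p ++ [ z i ]
  factor-slide z i p a = begin
    # a (factor z i p ++ [ z (i + p) ])    ≡⟨ cong (# a) (trans (sym (factor-∷ʳ z i p)) (factor-suc z i p)) ⟩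
    # a ([ z i ] ++ factor z (suc i) p)    ≡⟨ ∼-++-comm [ z i ] (factor z (suc i) p) a ⟩
    # a (factor z (suc i) p ++ [ z i ])    ∎
    where open ≡-Reasoning

  period⇒factor∼ : ∀ z i p → z (i + p) ≡ z i → factor z i p ∼ factor z (suc i) p
  period⇒factor∼ z i p z[i+p]≡z[i] =
    ∼-++-cancelʳ {factor z i p} {[ z i ]} {factor z (suc i) p} {[ z i ]}
      (λ a → trans (cong (λ b → # a (factor z i p ++ [ b ])) (sym z[i+p]≡z[i])) (factor-slide z i p a))
      (λ _ → refl)

  factor∼⇒period : ∀ z i p → factor z i p ∼ factor z (suc i) p → z (i + p) ≡ z i
  factor∼⇒period z i p F∼ =
    ∼-[]⇒≡ (∼-++-cancelˡ {factor z i p} {[ z (i + p) ]} {factor z (suc i) p} {[ z i ]} (factor-slide z i p) F∼)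

  hasPeriod⇒factors∼ : ∀ z p → HasPeriod p z → ∀ i → factor z i p ∼ factor z 0 p
  hasPeriod⇒factors∼ z p per zero    _ = refl
  hasPeriod⇒factors∼ z p per (suc i) a = trans (sym (period⇒factor∼ z i p (per i) a)) (hasPeriod⇒factors∼ z p per i a)

  factors∼⇒hasPeriod : ∀ z p {w} → (∀ i → factor z i p ∼ w) → HasPeriod p z
  factors∼⇒hasPeriod z p F∼w i = factor∼⇒period z i p (λ a → trans (F∼w i a) (sym (F∼w (suc i) a)))

  closure-factor : ∀ x y → InAbClosure _≟_ x y → ∀ i n → ∃ λ j → factor y i n ∼ factor x j n
  closure-factor x y y∈ i n with y∈ (factor y i n) (factor-isFactor y i n)
  ... | v , (j , v≡) , F∼v = j , λ a → trans (F∼v a) (cong (# a) (trans v≡ (cong (factor x j) ∣v∣≡n)))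
    where
    ∣v∣≡n : length v ≡ n
    ∣v∣≡n = trans (sym (∼⇒length≡ (factor y i n) v F∼v)) (factor-length y i n)

  closure-hasPeriod : ∀ x y p → HasPeriod p x → InAbClosure _≟_ x y → HasPeriod p y
  closure-hasPeriod x y p per y∈ = factors∼⇒hasPeriod y p {factor x 0 p} λ i →
    let j , F∼ = closure-factor x y y∈ i p in λ a → trans (F∼ a) (hasPeriod⇒factors∼ x p per j a)

  closure-letter : ∀ x y → InAbClosure _≟_ x y → ∀ i → ∃ λ j → y i ≡ x j
  -- factor y i 1 computes to [ y (i + 0) ], hence the +-identityʳ.
  closure-letter x y y∈ i with closure-factor x y y∈ i 1
  ... | j , F∼ = j , subst₂ (λ m n → y m ≡ x n) (+-identityʳ i) (+-identityʳ j) (∼-[]⇒≡ F∼)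

  FiniteSet-⊆ : {S T : InfWord _≟_ → Set} → (∀ y → S y → T y) → FiniteSet _≟_ T → FiniteSet _≟_ S
  FiniteSet-⊆ S⊆T (C , covers) = C , λ y → covers y ∘ S⊆T y

  periodicWords-finite : (L : List A) (k : ℕ) →
    FiniteSet _≟_ (λ y → HasPeriod (suc k) y × (∀ n → y n ∈ L))
  periodicWords-finite L k = map cycle (vecsOver L (suc k)) , λ y (per , y⊆L) →
    let w = tabulate (y ∘ toℕ) in
    cycle w ,
    ∈-map⁺ cycle (∈-vecsOver w (λ i → subst (_∈ L) (sym (lookup∘tabulate (y ∘ toℕ) i)) (y⊆L (toℕ i)))) ,
    hasPeriod⇒≡cycle per

mainTheorem7 : {A : Set} (_≟_ : DecidableEquality A) (x : InfWord _≟_) →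
    IsPurelyPeriodic _≟_ x → FiniteSet _≟_ (InAbClosure _≟_ x)
mainTheorem7 _≟_ x (k , v , x≡cycle) =
  FiniteSet-⊆ _≟_ (λ y y∈ → closure-hasPeriod _≟_ x y (suc k) x-periodic y∈ , letters∈v y y∈)
    (periodicWords-finite _≟_ (toList v) k)
  where
  x-periodic : HasPeriod (suc k) x
  x-periodic i = trans (x≡cycle (i + suc k)) (trans (cycle-hasPeriod v i) (sym (x≡cycle i)))

  letters∈v : ∀ y → InAbClosure _≟_ x y → ∀ n → y n ∈ toList v
  letters∈v y y∈ n with closure-letter _≟_ x y y∈ n
  ... | j , y≡x = subst (_∈ toList v) (sym (trans y≡x (x≡cycle j))) (∈-toList⁺ (∈-lookup (j mod suc k) v))
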